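{- A graph $G$ admits an identical biarithmetic IASI if and only if $G$ is bipartite.
   Context: All graphs are simple and finite with no isolated vertices. Let $\mathbb{N}_0$ be the set of non-negative integers and $\mathcal{P}(\mathbb{N}_0)$ its power set; label sets are finite and non-empty. For sets $A,B$, $A+B=\{a+b: a\in A, b\in B\}$. An integer additive set-indexer (IASI) of $G$ is an injective map $f:V(G)\to\mathcal{P}(\mathbb{N}_0)$ such that $f^+:E(G)\to\mathcal{P}(\mathbb{N}_0)$, $f^+(uv)=f(u)+f(v)$, is also injective. An AP-set is a finite set of integers with at least three elements forming an arithmetic progression; its common difference is the deterministic index of the element it labels. An IASI is arithmetic if all vertex labels and edge labels are AP-sets. The deterministic ratio of an edge is the ratio ($\ge 1$) of the larger to the smaller deterministic index of its end vertices. A biarithmetic IASI is an arithmetic IASI $f$ such that for every edge $uv$, writing $d_u\le d_v$ for the deterministic indices of its ends, $d_v=k\,d_u$ for some integer $k$ with $1<k\le |f(u)|$. A biarithmetic IASI is identical if all edges of $G$ have the same deterministic ratio. -}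

module Defs where

open import Data.Nat using (ℕ; _+_; _*_; _≤_; _<_)
open import Data.Fin using (Fin)
open import Data.Bool using (Bool)
open import Data.List using (List; [])
open import Data.List.Membership.Propositional using (_∈_)
open import Data.Product using (Σ; ∃; ∃-syntax; _×_; _,_)
open import Data.Sum using (_⊎_)
open import Relation.Binary.PropositionalEquality using (_≡_; _≢_)
open import Relation.Nullary using (¬_)

record Graph (n : ℕ) : Set₁ where
  field
    Adj        : Fin n → Fin n → Set
    sym        : ∀ {u v} → Adj u v → Adj v u
    irrefl     : ∀ {u} → ¬ Adj u u
    noIsolated : ∀ u → ∃[ v ] Adj u v
open Graph public

SetN : Set₁
SetN = ℕ → Set

_≐_ : SetN → SetN → Set
A ≐ B = ∀ x → (A x → B x) × (B x → A x)

_⊕_ : SetN → SetN → SetN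
(A ⊕ B) x = ∃[ a ] ∃[ b ] (A a × B b × x ≡ a + b)

FinNonEmpty : SetN → Set
FinNonEmpty A = Σ (List ℕ) (λ xs → xs ≢ [] × (∀ x → (A x → x ∈ xs) × (x ∈ xs → A x)))

AP : ℕ → ℕ → ℕ → SetN
AP a d m x = ∃[ i ] (i < m × x ≡ a + i * d)

-- A is an AP-set with common difference (deterministic index) d and
-- cardinality m (at least three elements, d ≥ 1 so elements are distinct).
HasAP : SetN → ℕ → ℕ → Set
HasAP A d m = ∃[ a ] (1 ≤ d × 3 ≤ m × A ≐ AP a d m)

IsAPSet : SetN → Set
IsAPSet A = ∃[ d ] ∃[ m ] HasAP A d m

record IsIASI {n : ℕ} (G : Graph n) (f : Fin n → SetN) : Set where
  field
    labelsFinNonEmpty : ∀ u → FinNonEmpty (f u)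
    vertexInjective   : ∀ u v → f u ≐ f v → u ≡ v
    edgeInjective     : ∀ u v x y → Adj G u v → Adj G x y →
                        (f u ⊕ f v) ≐ (f x ⊕ f y) →
                        (u ≡ x × v ≡ y) ⊎ (u ≡ y × v ≡ x)

record IsArithmeticIASI {n : ℕ} (G : Graph n) (f : Fin n → SetN) : Set where
  field
    iasi        : IsIASI G f
    vertexAP    : ∀ u → IsAPSet (f u)
    edgeAP      : ∀ u v → Adj G u v → IsAPSet (f u ⊕ f v)

-- Biarithmetic: for every edge uv with d_u ≤ d_v, d_v = k d_u, 1 < k ≤ |f(u)|.
-- (Edges are unordered: Adj is symmetric, so both orientations are covered.)
record IsBiarithmeticIASI {n : ℕ} (G : Graph n) (f : Fin n → SetN) : Set where
  field
    arithmetic : IsArithmeticIASI G f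
    biarith    : ∀ u v → Adj G u v → ∀ du mu dv mv →
                 HasAP (f u) du mu → HasAP (f v) dv mv → du ≤ dv →
                 ∃[ k ] (1 < k × k ≤ mu × dv ≡ k * du)

-- Identical: all edges have the same deterministic ratio r = d_v / d_u
-- (an integer for biarithmetic IASIs).
record IsIdenticalBiarithmeticIASI {n : ℕ} (G : Graph n) (f : Fin n → SetN) : Set where
  field
    biarithmetic : IsBiarithmeticIASI G f
    sameRatio    : ∃[ r ] (∀ u v → Adj G u v → ∀ du mu dv mv →
                   HasAP (f u) du mu → HasAP (f v) dv mv → du ≤ dv →
                   dv ≡ r * du)

Bipartite : {n : ℕ} → Graph n → Set
Bipartite {n} G = Σ (Fin n → Bool) (λ c → ∀ u v → Adj G u v → c u ≢ c v)

-- If all edges have deterministic ratio r, then r ≥ 2 and the deterministic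
-- index is multiplied by r along every edge, so the parity of ⌊log_r d⌋
-- changes across every edge and 2-colours the graph. Conversely, for a
-- 2-colouring, give a vertex of colour true the set {i, i+1, i+2} and a vertex
-- of colour false the set {(j+1)n, (j+1)n+3, (j+1)n+6}, where i, j < n are
-- the vertex numbers (ratio 3, the largest three-element labels allow): every
-- edge set is then the AP-set {s, …, s+8}, whose least element s = i + (j+1)n
-- determines both ends.
module Submission where

open import Defs
open import Data.Bool using (Bool; true; false; not)
open import Data.Bool.Properties using (not-¬)
open import Data.Empty using (⊥-elim)
open import Data.Fin using (Fin; toℕ)
open import Data.Fin.Properties using (toℕ<n; toℕ-injective)
open import Data.List using (applyUpTo)
open import Data.List.Membership.Propositional.Properties using (∈-applyUpTo⁺; ∈-applyUpTo⁻)
open import Data.Nat using (ℕ; zero; suc; _+_; _*_; _^_; _≤_; _<_; z≤n; s≤s; z<s; NonZero; >-nonZero)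
open import Data.Nat.DivMod using (_%_; _/_; m≡m%n+[m/n]*n; [m+kn]%n≡m%n; m<n⇒m%n≡m; m%n<n; m<n*o⇒m/o<n)
open import Data.Nat.Properties
open import Data.Nat.Tactic.RingSolver using (solve-∀)
open import Data.Product using (Σ; ∃-syntax; _×_; _,_; proj₁; proj₂; swap) renaming (map to ×-map)
open import Data.Sum using (_⊎_; inj₁; inj₂) renaming (map to ⊎-map)
import Relation.Binary.PropositionalEquality as ≡
open ≡ using (_≡_; _≢_; refl; cong; ≢-sym; subst)
open import Relation.Nullary using (¬_)

≐-refl : ∀ {A} → A ≐ A
≐-refl x = (λ a → a) , (λ a → a)

≐-sym : ∀ {A B} → A ≐ B → B ≐ A
≐-sym A≐B x = proj₂ (A≐B x) , proj₁ (A≐B x)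

≐-trans : ∀ {A B C} → A ≐ B → B ≐ C → A ≐ C
≐-trans A≐B B≐C x = (λ a → proj₁ (B≐C x) (proj₁ (A≐B x) a))
                  , (λ c → proj₂ (A≐B x) (proj₂ (B≐C x) c))

⊕-comm : ∀ A B → (A ⊕ B) ≐ (B ⊕ A)
⊕-comm A B x = flip , flip
  where
  flip : ∀ {A B} → (A ⊕ B) x → (B ⊕ A) x
  flip (a , b , Aa , Bb , x≡a+b) = b , a , Bb , Aa , ≡.trans x≡a+b (+-comm a b)

IsLeast : SetN → ℕ → Set
IsLeast A a = A a × (∀ x → A x → a ≤ x)

_above_ : SetN → ℕ → SetN
(A above a) x = A x × a < x

IsLeast-unique : ∀ {A a a'} → IsLeast A a → IsLeast A a' → a ≡ a'
IsLeast-unique (Aa , a≤) (Aa' , a'≤) = ≤-antisym (a≤ _ Aa') (a'≤ _ Aa)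

IsLeast-cong : ∀ {A B a} → A ≐ B → IsLeast A a → IsLeast B a
IsLeast-cong {a = a} A≐B (Aa , a≤) = proj₁ (A≐B a) Aa , λ x Bx → a≤ x (proj₂ (A≐B x) Bx)

above-cong : ∀ {A B} a → A ≐ B → (A above a) ≐ (B above a)
above-cong a A≐B x = (λ (Ax , a<x) → proj₁ (A≐B x) Ax , a<x)
                   , (λ (Bx , a<x) → proj₂ (A≐B x) Bx , a<x)

IsLeast-⊕ : ∀ {A B a b} → IsLeast A a → IsLeast B b → IsLeast (A ⊕ B) (a + b)
IsLeast-⊕ (Aa , a≤) (Bb , b≤) =
  (_ , _ , Aa , Bb , refl) ,
  λ { x (a' , b' , Aa' , Bb' , refl) → +-mono-≤ (a≤ a' Aa') (b≤ b' Bb') }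

AP-finNonEmpty : ∀ a d m → FinNonEmpty (AP a d (suc m))
AP-finNonEmpty a d m = applyUpTo term (suc m) , (λ ()) , λ x → listed x , ∈-applyUpTo⁻ term
  where
  term : ℕ → ℕ
  term i = a + i * d
  listed : ∀ x → AP a d (suc m) x → _
  listed x (i , i<m , refl) = ∈-applyUpTo⁺ term i<m

AP-isLeast : ∀ a d {m} → 0 < m → IsLeast (AP a d m) a
AP-isLeast a d 0<m = (0 , 0<m , ≡.sym (+-identityʳ a)) , λ { x (i , _ , refl) → m≤m+n a (i * d) }

AP-second : ∀ a {d m} → 0 < d → 2 ≤ m → IsLeast (AP a d m above a) (a + d)
AP-second a {d} {m} 0<d 2≤m =
  ((1 , 2≤m , cong (a +_) (≡.sym (*-identityˡ d))) , m<m+n a 0<d) , least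
  where
  least : ∀ x → (AP a d m above a) x → a + d ≤ x
  least x ((zero  , _ , refl) , a<a+0) = ⊥-elim (<-irrefl (≡.sym (+-identityʳ a)) a<a+0)
  least x ((suc i , _ , refl) , _)     = +-monoʳ-≤ a (m≤m+n d (i * d))

HasAP-least : ∀ {A d m} → HasAP A d m → ∃[ a ] (IsLeast A a × IsLeast (A above a) (a + d))
HasAP-least (a , 0<d , 3≤m , A≐AP) =
  a , IsLeast-cong AP≐A (AP-isLeast a _ (≤-trans z<s 3≤m))
    , IsLeast-cong (above-cong a AP≐A) (AP-second a 0<d (≤-trans (s≤s z<s) 3≤m))
  where
  AP≐A = ≐-sym A≐AP

HasAP-unique-difference : ∀ {A d m d' m'} → HasAP A d m → HasAP A d' m' → d ≡ d'
HasAP-unique-difference hasAP hasAP'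
  with a , least , second ← HasAP-least hasAP
     | a' , least' , second' ← HasAP-least hasAP'
  with refl ← IsLeast-unique least least'
  = +-cancelˡ-≡ a _ _ (IsLeast-unique second second')

regroup : ∀ a b i j m → (a + i * 1) + (b + j * m) ≡ (a + b) + (i + j * m) * 1
regroup = solve-∀

-- Base-m digits: {0, …, m-1} + {0, m, …, (k-1)m} = {0, …, mk-1}.
AP-digits : ∀ a b m k .{{_ : NonZero m}} → (AP a 1 m ⊕ AP b m k) ≐ AP (a + b) 1 (m * k)
AP-digits a b m k x = combine , split
  where
  combine : (AP a 1 m ⊕ AP b m k) x → AP (a + b) 1 (m * k) x
  combine (_ , _ , (i , i<m , refl) , (j , j<k , refl) , refl) = i + j * m , bound , regroup a b i j m
    where
    bound : i + j * m < m * k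
    bound = begin-strict
      i + j * m   <⟨ +-monoˡ-< (j * m) i<m ⟩
      suc j * m   ≤⟨ *-monoˡ-≤ m j<k ⟩
      k * m       ≡⟨ *-comm k m ⟩
      m * k       ∎
      where open ≤-Reasoning
  split : AP (a + b) 1 (m * k) x → (AP a 1 m ⊕ AP b m k) x
  split (t , t<mk , refl) =
    a + (t % m) * 1 , b + (t / m) * m ,
    (t % m , m%n<n t m , refl) , (t / m , m<n*o⇒m/o<n (≤-trans t<mk (≤-reflexive (*-comm m k))) , refl) ,
    ≡.trans (cong (λ s → (a + b) + s * 1) (m≡m%n+[m/n]*n t m)) (≡.sym (regroup a b (t % m) (t / m) m))

IsFloorLog : ℕ → ℕ → ℕ → Set
IsFloorLog b d k = b ^ k ≤ d × d < b ^ suc k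

floorLog : ∀ b → 1 < b → ∀ d → 0 < d → ∃[ k ] IsFloorLog b d k
floorLog b 1<b (suc zero)    _ = 0 , ≤-refl , ≤-trans 1<b (≤-reflexive (≡.sym (*-identityʳ b)))
floorLog b 1<b (suc (suc d)) _
  with k , bᵏ≤d , d<bᵏ⁺¹ ← floorLog b 1<b (suc d) z<s
  with m≤n⇒m<n∨m≡n d<bᵏ⁺¹
... | inj₁ d+1<bᵏ⁺¹ = k , ≤-trans bᵏ≤d (n≤1+n _) , d+1<bᵏ⁺¹
... | inj₂ d+1≡bᵏ⁺¹ = suc k , ≤-reflexive (≡.sym d+1≡bᵏ⁺¹)
                            , subst (_< b ^ suc (suc k)) (≡.sym d+1≡bᵏ⁺¹) (^-monoʳ-< b 1<b (n<1+n (suc k)))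

IsFloorLog-unique : ∀ {b d k k'} → 1 < b → IsFloorLog b d k → IsFloorLog b d k' → k ≡ k'
IsFloorLog-unique {b} {d} 1<b log log' = ≤-antisym (≮⇒≥ (not-below log' log)) (≮⇒≥ (not-below log log'))
  where
  instance
    b≢0 : NonZero b
    b≢0 = >-nonZero (<-trans z<s 1<b)
  not-below : ∀ {k k'} → IsFloorLog b d k → IsFloorLog b d k' → ¬ k < k'
  not-below (_ , d<bᵏ⁺¹) (bᵏ'≤d , _) k<k' = <⇒≱ d<bᵏ⁺¹ (≤-trans (^-monoʳ-≤ b k<k') bᵏ'≤d)

IsFloorLog-* : ∀ {b d k} .{{_ : NonZero b}} → IsFloorLog b d k → IsFloorLog b (b * d) (suc k)
IsFloorLog-* {b} (bᵏ≤d , d<bᵏ⁺¹) = *-monoʳ-≤ b bᵏ≤d , *-monoʳ-< b d<bᵏ⁺¹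

even : ℕ → Bool
even zero    = true
even (suc k) = not (even k)

even-suc : ∀ k → even (suc k) ≢ even k
even-suc k = ≢-sym (not-¬ refl)

module ParityColouring {n : ℕ} (G : Graph n) (f : Fin n → SetN) (I : IsIdenticalBiarithmeticIASI G f) where
  open IsIdenticalBiarithmeticIASI I
  open IsBiarithmeticIASI biarithmetic
  open IsArithmeticIASI arithmetic

  r : ℕ
  r = proj₁ sameRatio

  index : Fin n → ℕ
  index u = proj₁ (vertexAP u)

  size : Fin n → ℕ
  size u = proj₁ (proj₂ (vertexAP u))

  hasAP : ∀ u → HasAP (f u) (index u) (size u)
  hasAP u = proj₂ (proj₂ (vertexAP u))

  index-positive : ∀ u → 0 < index u
  index-positive u = proj₁ (proj₂ (hasAP u))

  edge-ratio : ∀ {u v} → Adj G u v → index u ≤ index v → 1 < r × index v ≡ r * index u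
  edge-ratio {u} {v} uv du≤dv
    with k , 1<k , _ , dv≡k*du ← biarith u v uv _ _ _ _ (hasAP u) (hasAP v) du≤dv
    = subst (1 <_) k≡r 1<k , dv≡r*du
    where
    instance
      du≢0 : NonZero (index u)
      du≢0 = >-nonZero (index-positive u)
    dv≡r*du = proj₂ sameRatio u v uv _ _ _ _ (hasAP u) (hasAP v) du≤dv
    k≡r = *-cancelʳ-≡ k r (index u) (≡.trans (≡.sym dv≡k*du) dv≡r*du)

  1<r : Fin n → 1 < r
  1<r u with v , uv ← noIsolated G u | ≤-total (index u) (index v)
  ... | inj₁ du≤dv = proj₁ (edge-ratio uv du≤dv)
  ... | inj₂ dv≤du = proj₁ (edge-ratio (sym G uv) dv≤du)

  logIndex : Fin n → ℕ
  logIndex u = proj₁ (floorLog r (1<r u) (index u) (index-positive u))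

  colour : Fin n → Bool
  colour u = even (logIndex u)

  colour-proper : ∀ {u v} → Adj G u v → index u ≤ index v → colour u ≢ colour v
  colour-proper {u} {v} uv du≤dv cu≡cv =
    even-suc (logIndex u) (≡.trans (cong even (≡.sym logv≡1+logu)) (≡.sym cu≡cv))
    where
    instance
      r≢0 : NonZero r
      r≢0 = >-nonZero (<-trans z<s (1<r u))
    dv≡r*du = proj₂ (edge-ratio uv du≤dv)
    logu : IsFloorLog r (index u) (logIndex u)
    logu = proj₂ (floorLog r (1<r u) (index u) (index-positive u))
    logv : IsFloorLog r (index v) (logIndex v)
    logv = proj₂ (floorLog r (1<r v) (index v) (index-positive v))
    logv≡1+logu : logIndex v ≡ suc (logIndex u)
    logv≡1+logu = IsFloorLog-unique (1<r u) logv
      (subst (λ d → IsFloorLog r d (suc (logIndex u))) (≡.sym dv≡r*du) (IsFloorLog-* {k = logIndex u} logu))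

  bipartite : Bipartite G
  bipartite = colour , proper
    where
    proper : ∀ u v → Adj G u v → colour u ≢ colour v
    proper u v uv with ≤-total (index u) (index v)
    ... | inj₁ du≤dv = colour-proper uv du≤dv
    ... | inj₂ dv≤du = ≢-sym (colour-proper (sym G uv) dv≤du)

start : ℕ → Bool → ℕ → ℕ
start n true  i = i
start n false i = suc i * n

difference : Bool → ℕ
difference true  = 1
difference false = 3

digits-unique : ∀ {n i i' k k'} → i < n → i' < n → i + k * n ≡ i' + k' * n → i ≡ i' × k ≡ k'
digits-unique {n} {i} {i'} {k} {k'} i<n i'<n eq =
  i≡i' , *-cancelʳ-≡ k k' n (+-cancelˡ-≡ i _ _ (≡.trans eq (cong (_+ k' * n) (≡.sym i≡i'))))
  where
  instance
    n≢0 : NonZero n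
    n≢0 = >-nonZero (≤-trans z<s i<n)
  open ≡.≡-Reasoning
  i≡i' : i ≡ i'
  i≡i' = begin
    i                  ≡⟨ m<n⇒m%n≡m i<n ⟨
    i % n              ≡⟨ [m+kn]%n≡m%n i k n ⟨
    (i + k * n) % n    ≡⟨ cong (_% n) eq ⟩
    (i' + k' * n) % n  ≡⟨ [m+kn]%n≡m%n i' k' n ⟩
    i' % n             ≡⟨ m<n⇒m%n≡m i'<n ⟩
    i'                 ∎

start-injective : ∀ {n} b b' {i j} → i < n → j < n → start n b i ≡ start n b' j → i ≡ j
start-injective true  true  _   _   eq = eq
start-injective {n} false false {i} {j} i<n _ eq = suc-injective (*-cancelʳ-≡ (suc i) (suc j) n eq)
  where
  instance
    n≢0 : NonZero n
    n≢0 = >-nonZero (≤-trans z<s i<n)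
start-injective {n} true false {j = j} i<n _ eq = ⊥-elim (<⇒≱ i<n (≤-trans (m≤m+n n (j * n)) (≤-reflexive (≡.sym eq))))
start-injective {n} false true {i} _ j<n eq = ⊥-elim (<⇒≱ j<n (≤-trans (m≤m+n n (i * n)) (≤-reflexive eq)))

digits-unique-suc : ∀ {n i i' j j'} → i < n → i' < n → i + suc j * n ≡ i' + suc j' * n → i ≡ i' × j ≡ j'
digits-unique-suc i<n i'<n eq with i≡i' , 1+j≡1+j' ← digits-unique i<n i'<n eq = i≡i' , suc-injective 1+j≡1+j'

start-sum-injective : ∀ {n} b₁ b₂ b₃ b₄ {i₁ i₂ i₃ i₄} → b₁ ≢ b₂ → b₃ ≢ b₄ →
  i₁ < n → i₂ < n → i₃ < n → i₄ < n →
  start n b₁ i₁ + start n b₂ i₂ ≡ start n b₃ i₃ + start n b₄ i₄ →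
  (i₁ ≡ i₃ × i₂ ≡ i₄) ⊎ (i₁ ≡ i₄ × i₂ ≡ i₃)
start-sum-injective true  true  _ _ b₁≢b₂ _ _ _ _ _ _ = ⊥-elim (b₁≢b₂ refl)
start-sum-injective false false _ _ b₁≢b₂ _ _ _ _ _ _ = ⊥-elim (b₁≢b₂ refl)
start-sum-injective _ _ true  true  _ b₃≢b₄ _ _ _ _ _ = ⊥-elim (b₃≢b₄ refl)
start-sum-injective _ _ false false _ b₃≢b₄ _ _ _ _ _ = ⊥-elim (b₃≢b₄ refl)
start-sum-injective true false true false _ _ i₁<n _ i₃<n _ eq =
  inj₁ (digits-unique-suc i₁<n i₃<n eq)
start-sum-injective true false false true {i₄ = i₄} _ _ i₁<n _ _ i₄<n eq =
  inj₂ (digits-unique-suc i₁<n i₄<n (≡.trans eq (+-comm _ i₄)))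
start-sum-injective false true true false {i₂ = i₂} _ _ _ i₂<n i₃<n _ eq =
  inj₂ (swap (digits-unique-suc i₂<n i₃<n (≡.trans (+-comm i₂ _) eq)))
start-sum-injective false true false true {i₂ = i₂} {i₄ = i₄} _ _ _ i₂<n _ i₄<n eq =
  inj₁ (swap (digits-unique-suc i₂<n i₄<n (≡.trans (+-comm i₂ _) (≡.trans eq (+-comm _ i₄)))))

difference-ratio : ∀ b b' → b ≢ b' → difference b ≤ difference b' → difference b' ≡ 3 * difference b
difference-ratio true  true  b≢b' _ = ⊥-elim (b≢b' refl)
difference-ratio false false b≢b' _ = ⊥-elim (b≢b' refl)
difference-ratio true  false _    _ = refl
difference-ratio false true  _    (s≤s ())

AP-difference-sum : ∀ b b' → b ≢ b' → ∀ a a' → IsAPSet (AP a (difference b) 3 ⊕ AP a' (difference b') 3)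
AP-difference-sum true  true  b≢b' _ _  = ⊥-elim (b≢b' refl)
AP-difference-sum false false b≢b' _ _  = ⊥-elim (b≢b' refl)
AP-difference-sum true  false _    a a' = 1 , 9 , a + a' , ≤-refl , s≤s (s≤s (s≤s z≤n)) , AP-digits a a' 3 3
AP-difference-sum false true  _    a a' =
  1 , 9 , a' + a , ≤-refl , s≤s (s≤s (s≤s z≤n)) , ≐-trans (⊕-comm _ _) (AP-digits a' a 3 3)

module StartLabelling {n : ℕ} (G : Graph n) (colour : Fin n → Bool)
                      (proper : ∀ u v → Adj G u v → colour u ≢ colour v) where

  first : Fin n → ℕ
  first u = start n (colour u) (toℕ u)

  label : Fin n → SetN
  label u = AP (first u) (difference (colour u)) 3

  label-AP : ∀ u → HasAP (label u) (difference (colour u)) 3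
  label-AP u = first u , positive (colour u) , ≤-refl , ≐-refl
    where
    positive : ∀ b → 0 < difference b
    positive true  = z<s
    positive false = z<s

  label-least : ∀ u → IsLeast (label u) (first u)
  label-least u = AP-isLeast _ _ z<s

  edge-ratio : ∀ {u v du mu dv mv} → Adj G u v → HasAP (label u) du mu → HasAP (label v) dv mv →
               du ≤ dv → dv ≡ 3 * du
  edge-ratio {u} {v} uv hu hv du≤dv
    with refl ← HasAP-unique-difference hu (label-AP u)
       | refl ← HasAP-unique-difference hv (label-AP v)
    = difference-ratio (colour u) (colour v) (proper u v uv) du≤dv

  vertex-injective : ∀ u v → label u ≐ label v → u ≡ v
  vertex-injective u v lu≐lv =
    toℕ-injective (start-injective (colour u) (colour v) (toℕ<n u) (toℕ<n v)
      (IsLeast-unique (IsLeast-cong lu≐lv (label-least u)) (label-least v)))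

  edge-injective : ∀ u v x y → Adj G u v → Adj G x y → (label u ⊕ label v) ≐ (label x ⊕ label y) →
                   (u ≡ x × v ≡ y) ⊎ (u ≡ y × v ≡ x)
  edge-injective u v x y uv xy uv≐xy =
    ⊎-map (×-map toℕ-injective toℕ-injective) (×-map toℕ-injective toℕ-injective)
      (start-sum-injective (colour u) (colour v) (colour x) (colour y) (proper u v uv) (proper x y xy)
        (toℕ<n u) (toℕ<n v) (toℕ<n x) (toℕ<n y)
        (IsLeast-unique (IsLeast-cong uv≐xy (IsLeast-⊕ (label-least u) (label-least v)))
                        (IsLeast-⊕ (label-least x) (label-least y))))

  isIdentical : IsIdenticalBiarithmeticIASI G label
  isIdentical = record
    { biarithmetic = record
      { arithmetic = record
        { iasi = record
          { labelsFinNonEmpty = λ u → AP-finNonEmpty (first u) (difference (colour u)) 2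
          ; vertexInjective   = vertex-injective
          ; edgeInjective     = edge-injective
          }
        ; vertexAP = λ u → difference (colour u) , 3 , label-AP u
        ; edgeAP   = λ u v uv → AP-difference-sum (colour u) (colour v) (proper u v uv) (first u) (first v)
        }
      ; biarith = λ u v uv _ _ _ _ hu hv du≤dv →
          3 , s≤s (s≤s z≤n) , proj₁ (proj₂ (proj₂ hu)) , edge-ratio uv hu hv du≤dv
      }
    ; sameRatio = 3 , λ u v uv _ _ _ _ hu hv → edge-ratio uv hu hv
    }

theorem3p4 : (n : ℕ) (G : Graph n) →
    ((Σ (Fin n → SetN) (λ f → IsIdenticalBiarithmeticIASI G f)) → Bipartite G) ×
    (Bipartite G → Σ (Fin n → SetN) (λ f → IsIdenticalBiarithmeticIASI G f))
theorem3p4 n G =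
  (λ (f , I) → ParityColouring.bipartite G f I) ,
  (λ (colour , proper) → StartLabelling.label G colour proper , StartLabelling.isIdentical G colour proper)
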